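{- For all integers $0\leq t\leq r\leq n$, $$\frac{1}{\binom{n}{r}} \log(m_{n,r}+1) \leq \frac{1}{\binom{n-t}{r-t}} \log(m_{n-t, r-t}+1).$$
   Context: A matroid is a pair $(E,\mathcal{B})$ where $E$ is a finite set and $\mathcal{B}$ is a nonempty collection of subsets of $E$ satisfying the base exchange axiom: for all $B,B'\in\mathcal{B}$ and all $e\in B\setminus B'$ there exists $f\in B'\setminus B$ such that $(B\setminus\{e\})\cup\{f\}\in\mathcal{B}$. All members of $\mathcal{B}$ (the bases) have the same cardinality $r$, the rank of the matroid. $m_{n,r}$ denotes the number of matroids of rank $r$ on the ground set $[n]=\{1,\dots,n\}$ (i.e. the number of nonempty collections $\mathcal{B}$ of $r$-subsets of $[n]$ satisfying the base exchange axiom). $\log$ denotes the logarithm to base $2$. -}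

module Defs where

open import Data.Nat using (ℕ; zero; suc; _<_; _≟_; _<?_)
open import Data.Bool using (Bool; true; false)
import Data.Bool.Properties as BoolP
open import Data.Fin using (Fin)
open import Data.Fin.Subset using (Subset; _∈_; _∉_; ∣_∣; _∪_; ⁅_⁆; _-_)
open import Data.Fin.Subset.Properties using (_∈?_)
import Data.Fin.Properties as FinP
open import Data.Vec using ([]; _∷_)
open import Data.Vec.Properties using (≡-dec)
open import Data.List using (List; []; _∷_; [_]; map; _++_; length; filter)
open import Data.List.Relation.Unary.All using (All)
import Data.List.Relation.Unary.All as All
open import Data.List.Membership.DecPropositional using ()
import Data.List.Membership.DecPropositional as DecMem
open import Data.List.Membership.Propositional using () renaming (_∈_ to _∈ₗ_)
open import Data.Product using (Σ; ∃; _×_; _,_)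
open import Relation.Binary.PropositionalEquality using (_≡_)
open import Relation.Binary.Definitions using (DecidableEquality)
open import Relation.Nullary using (Dec; ¬_)
open import Relation.Nullary.Decidable using (_×-dec_; ¬?; _→-dec_)

allSubsets : (n : ℕ) → List (Subset n)
allSubsets zero = [ [] ]
allSubsets (suc n) = map (true ∷_) (allSubsets n) ++ map (false ∷_) (allSubsets n)

sublists : ∀ {a} {A : Set a} → List A → List (List A)
sublists [] = [ [] ]
sublists (x ∷ xs) = map (x ∷_) (sublists xs) ++ sublists xs

-- A collection of subsets of [n] is represented as a list of subsets;
-- the collections of subsets of [n] are enumerated (without repetition)
-- as the sublists of allSubsets n.
Collection : ℕ → Set
Collection n = List (Subset n)

subset-≟ : ∀ {n} → DecidableEquality (Subset n)
subset-≟ = ≡-dec BoolP._≟_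

_∈𝓑_ : ∀ {n} → Subset n → Collection n → Set
S ∈𝓑 𝓑 = S ∈ₗ 𝓑

_∈𝓑?_ : ∀ {n} (S : Subset n) (𝓑 : Collection n) → Dec (S ∈𝓑 𝓑)
S ∈𝓑? 𝓑 = DecMem._∈?_ subset-≟ S 𝓑

ExchangeAt : ∀ {n} → Collection n → Subset n → Subset n → Set
ExchangeAt {n} 𝓑 B B' =
  (e : Fin n) → e ∈ B → e ∉ B' →
  ∃ λ (f : Fin n) → f ∈ B' × f ∉ B × (((B - e) ∪ ⁅ f ⁆) ∈𝓑 𝓑)

BaseExchange : ∀ {n} → Collection n → Set
BaseExchange 𝓑 = All (λ B → All (λ B' → ExchangeAt 𝓑 B B') 𝓑) 𝓑

IsMatroid : ∀ {n} → ℕ → Collection n → Set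
IsMatroid r 𝓑 = (0 < length 𝓑) × All (λ B → ∣ B ∣ ≡ r) 𝓑 × BaseExchange 𝓑

exchangeAt? : ∀ {n} (𝓑 : Collection n) B B' → Dec (ExchangeAt 𝓑 B B')
exchangeAt? 𝓑 B B' = FinP.all? λ e → (e ∈? B) →-dec ((¬? (e ∈? B')) →-dec
  FinP.any? λ f → (f ∈? B') ×-dec (¬? (f ∈? B) ×-dec (((B - e) ∪ ⁅ f ⁆) ∈𝓑? 𝓑)))

isMatroid? : ∀ {n} (r : ℕ) (𝓑 : Collection n) → Dec (IsMatroid r 𝓑)
isMatroid? r 𝓑 = (0 <? length 𝓑) ×-dec (All.all? (λ B → ∣ B ∣ ≟ r) 𝓑
  ×-dec All.all? (λ B → All.all? (λ B' → exchangeAt? 𝓑 B B') 𝓑) 𝓑)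

m : ℕ → ℕ → ℕ
m n r = length (filter (isMatroid? r) (sublists (allSubsets n)))

-- Let M(n,r) = m n r + 1. For an element e of [n+1], the bases of a rank-(r+1) matroid that
-- contain e, with e removed, form a rank-r matroid on [n] or the empty family. Every basis
-- contains exactly r + 1 elements, so Shearer's lemma gives M(n+1,r+1)^(r+1) ≤ M(n,r)^(n+1).
-- As (r+1)·C(n+1,r+1) = (n+1)·C(n,r), this says that log M(n,r) / C(n,r) does not decrease
-- when n and r both drop by one, and induction on t finishes.
-- Shearer's lemma is proved by induction on the ground set, each step being Hölder's inequality
-- (∏ aᵢ)^(1/R) + (∏ bᵢ)^(1/R) ≤ (∏ (aᵢ + bᵢ))^(1/R), which in turn follows from AM-GM; roots
-- are avoided throughout by raising both sides to the R-th power.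

module Submission where

open import Defs
open import Data.Nat
open import Data.Nat.Properties
open import Data.Nat.Combinatorics using (_C_; nC1≡n; nCk+nC[k+1]≡[n+1]C[k+1])
open import Data.Nat.Tactic.RingSolver using (solve-∀)
open import Data.Nat.ListAction using (sum; product)
open import Data.Bool using (Bool; true; false; if_then_else_; _∨_)
open import Data.Bool.Properties using (if-float; if-eta; T-≡)
open import Data.Fin using (Fin; zero; suc; punchIn; punchOut)
open import Data.Fin.Properties using (punchIn-punchOut)
open import Data.Fin.Subset using (Subset; ∣_∣; _∈_; _∉_; _∪_; _─_; _-_; ⁅_⁆; ⊥)
open import Data.Vec using (Vec; []; _∷_; lookup; insertAt; removeAt; zipWith)
open import Data.Vec.Properties
  using (insertAt-lookup; insertAt-punchIn; removeAt-insertAt; insertAt-removeAt; lookup⇒[]=; []=⇒lookup)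
open import Data.List using (List; []; _∷_; length; map; _++_; filter; filterᵇ)
open import Data.List.Properties using (length-map; length-++; filter-++; map-++; ++-identityʳ)
open import Data.List.Relation.Unary.All using (All; [])
import Data.List.Relation.Unary.All as All
open import Data.List.Membership.Propositional using () renaming (_∈_ to _∈ₗ_)
open import Data.List.Membership.Propositional.Properties using (∈-map∘filter⁺; ∈-map∘filter⁻)
open import Data.Product using (_×_; _,_; ∃; proj₁; proj₂; uncurry)
open import Data.Sum using (inj₁; inj₂)
open import Function using (_∘_; _⇔_; mk⇔; Equivalence)
open import Relation.Nullary using (Dec; yes; no; does; contradiction)
open import Relation.Nullary.Decidable using (dec-true; isYes≗does; toWitness; T?)
open import Relation.Unary using (Pred; Decidable)
open import Relation.Binary.PropositionalEquality

^-distribʳ-* : ∀ m n k → (m * n) ^ k ≡ m ^ k * n ^ k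
^-distribʳ-* m n zero    = refl
^-distribʳ-* m n (suc k) rewrite ^-distribʳ-* m n k = rearrange m n (m ^ k) (n ^ k)
  where
  rearrange : ∀ a b c d → a * b * (c * d) ≡ a * c * (b * d)
  rearrange = solve-∀

^-swap : ∀ x a b → (x ^ a) ^ b ≡ (x ^ b) ^ a
^-swap x a b = trans (^-*-assoc x a b) (trans (cong (x ^_) (*-comm a b)) (sym (^-*-assoc x b a)))

^-cancelʳ-≤ : ∀ k .{{_ : NonZero k}} {x y} → x ^ k ≤ y ^ k → x ≤ y
^-cancelʳ-≤ k xᵏ≤yᵏ = ≮⇒≥ λ y<x → <⇒≱ (^-monoˡ-< k y<x) xᵏ≤yᵏ

n^n≢0 : ∀ n → NonZero (n ^ n)
n^n≢0 zero      = _
n^n≢0 n@(suc _) = m^n≢0 n n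

-- AM-GM

bernoulli-≥ : ∀ x d k → x ^ k * (x + suc k * d) ≤ (x + d) ^ suc k
bernoulli-≥ x d zero = ≤-reflexive (identity x d)
  where
  identity : ∀ x d → 1 * (x + 1 * d) ≡ (x + d) * 1
  identity = solve-∀
bernoulli-≥ x d (suc k) = begin
  x ^ suc k * (x + suc (suc k) * d)
    ≤⟨ m≤m+n _ _ ⟩
  x * x ^ k * (x + suc (suc k) * d) + x ^ k * suc k * d * d
    ≡⟨ expand x d (x ^ k) k ⟩
  (x + d) * (x ^ k * (x + suc k * d))
    ≤⟨ *-monoʳ-≤ (x + d) (bernoulli-≥ x d k) ⟩
  (x + d) ^ suc (suc k) ∎
  where
  open ≤-Reasoning
  expand : ∀ x d c k → x * c * (x + (2 + k) * d) + c * (1 + k) * d * d ≡ (x + d) * (c * (x + (1 + k) * d))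
  expand = solve-∀

bernoulli-≤ : ∀ x d k → (x + d) ^ suc k ≤ x ^ suc k + suc k * ((x + d) ^ k * d)
bernoulli-≤ x d zero = ≤-reflexive (identity x d)
  where
  identity : ∀ x d → (x + d) * 1 ≡ x * 1 + 1 * (1 * d)
  identity = solve-∀
bernoulli-≤ x d (suc k) = begin
  (x + d) * (x + d) ^ suc k
    ≤⟨ *-monoʳ-≤ (x + d) (bernoulli-≤ x d k) ⟩
  (x + d) * (x ^ suc k + suc k * ((x + d) ^ k * d))
    ≡⟨ expand x d (x ^ suc k) ((x + d) ^ k) k ⟩
  x * x ^ suc k + d * x ^ suc k + suc k * ((x + d) * (x + d) ^ k * d)
    ≤⟨ +-monoˡ-≤ _ (+-monoʳ-≤ (x ^ suc (suc k)) (*-monoʳ-≤ d (^-monoˡ-≤ (suc k) (m≤m+n x d)))) ⟩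
  x * x ^ suc k + d * (x + d) ^ suc k + suc k * ((x + d) ^ suc k * d)
    ≡⟨ collect (x ^ suc (suc k)) d ((x + d) ^ suc k) k ⟩
  x ^ suc (suc k) + suc (suc k) * ((x + d) ^ suc k * d) ∎
  where
  open ≤-Reasoning
  expand : ∀ x d a b k → (x + d) * (a + (1 + k) * (b * d)) ≡ x * a + d * a + (1 + k) * ((x + d) * b * d)
  expand = solve-∀
  collect : ∀ a d y k → a + d * y + (1 + k) * (y * d) ≡ a + (2 + k) * (y * d)
  collect = solve-∀

-- Bernoulli's inequality at the base (1 + n) S with increment n (S + w) − (1 + n) S = n w − S,
-- one case for each sign of the increment.
am-gm-step-scaled : ∀ n S w → ((1 + n) * S) ^ n * ((1 + n) * (n * w)) ≤ (n * (S + w)) ^ suc n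
am-gm-step-scaled n S w with ≤-total S (n * w)
... | inj₁ S≤nw = begin
  A ^ n * ((1 + n) * (n * w))   ≡⟨ cong (λ z → A ^ n * ((1 + n) * z)) S+d≡nw ⟨
  A ^ n * ((1 + n) * (S + d))   ≡⟨ cong (A ^ n *_) (*-distribˡ-+ (1 + n) S d) ⟩
  A ^ n * (A + (1 + n) * d)     ≤⟨ bernoulli-≥ A d n ⟩
  (A + d) ^ suc n               ≡⟨ cong (_^ suc n) A+d≡M ⟩
  (n * (S + w)) ^ suc n         ∎
  where
  open ≤-Reasoning
  A = (1 + n) * S
  d = n * w ∸ S
  S+d≡nw : S + d ≡ n * w
  S+d≡nw = m+[n∸m]≡n S≤nw
  regroup : ∀ n S d → (1 + n) * S + d ≡ n * S + (S + d)
  regroup = solve-∀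
  A+d≡M : A + d ≡ n * (S + w)
  A+d≡M = trans (regroup n S d) (trans (cong (n * S +_) S+d≡nw) (sym (*-distribˡ-+ n S w)))
... | inj₂ nw≤S = +-cancelʳ-≤ Y _ _ (begin
  A ^ n * ((1 + n) * (n * w)) + Y   ≡⟨ factor (A ^ n) n (n * w) e ⟩
  A ^ n * ((1 + n) * (n * w + e))   ≡⟨ cong (λ z → A ^ n * ((1 + n) * z)) nw+e≡S ⟩
  A ^ n * A                         ≡⟨ *-comm (A ^ n) A ⟩
  A ^ suc n                         ≡⟨ cong (_^ suc n) M+e≡A ⟨
  (M + e) ^ suc n                   ≤⟨ bernoulli-≤ M e n ⟩
  M ^ suc n + (1 + n) * ((M + e) ^ n * e)  ≡⟨ cong (λ z → M ^ suc n + (1 + n) * (z ^ n * e)) M+e≡A ⟩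
  M ^ suc n + Y                     ∎)
  where
  open ≤-Reasoning
  A = (1 + n) * S
  M = n * (S + w)
  e = S ∸ n * w
  nw+e≡S : n * w + e ≡ S
  nw+e≡S = m+[n∸m]≡n nw≤S
  Y = (1 + n) * (A ^ n * e)
  regroup : ∀ n S w e → n * (S + w) + e ≡ n * S + (n * w + e)
  regroup = solve-∀
  M+e≡A : M + e ≡ A
  M+e≡A = trans (regroup n S w e) (trans (cong (n * S +_) nw+e≡S) (+-comm (n * S) S))
  factor : ∀ c n x e → c * ((1 + n) * x) + (1 + n) * (c * e) ≡ c * ((1 + n) * (x + e))
  factor = solve-∀

am-gm-step : ∀ n S w → suc n ^ suc n * (S ^ n * w) ≤ n ^ n * (S + w) ^ suc n
am-gm-step zero S w = begin
  1 * (1 * w)        ≡⟨ *-identityˡ (1 * w) ⟩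
  1 * w              ≤⟨ *-monoʳ-≤ 1 (m≤n+m w S) ⟩
  1 * (S + w)        ≡⟨ cong (1 *_) (*-identityʳ (S + w)) ⟨
  1 * ((S + w) * 1)  ∎
  where open ≤-Reasoning
am-gm-step n@(suc _) S w = *-cancelˡ-≤ n (begin
  n * (suc n ^ suc n * (S ^ n * w))             ≡⟨ rearrange n (suc n ^ n) (S ^ n) w ⟩
  suc n ^ n * S ^ n * ((1 + n) * (n * w))       ≡⟨ cong (_* ((1 + n) * (n * w))) (^-distribʳ-* (suc n) S n) ⟨
  ((1 + n) * S) ^ n * ((1 + n) * (n * w))       ≤⟨ am-gm-step-scaled n S w ⟩
  (n * (S + w)) ^ suc n                         ≡⟨ ^-distribʳ-* n (S + w) (suc n) ⟩
  n * n ^ n * (S + w) ^ suc n                   ≡⟨ *-assoc n (n ^ n) _ ⟩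
  n * (n ^ n * (S + w) ^ suc n)                 ∎)
  where
  open ≤-Reasoning
  rearrange : ∀ n p q w → n * ((1 + n) * p * (q * w)) ≡ p * q * ((1 + n) * (n * w))
  rearrange = solve-∀

am-gm : ∀ xs → length xs ^ length xs * product xs ≤ sum xs ^ length xs
am-gm []       = ≤-refl
am-gm (w ∷ xs) = *-cancelˡ-≤ (n ^ n) {{n^n≢0 n}} (begin
  n ^ n * (suc n ^ suc n * (w * product xs))    ≡⟨ rearrange (n ^ n) (suc n ^ suc n) w (product xs) ⟩
  suc n ^ suc n * w * (n ^ n * product xs)      ≤⟨ *-monoʳ-≤ (suc n ^ suc n * w) (am-gm xs) ⟩
  suc n ^ suc n * w * sum xs ^ n                ≡⟨ *-assoc (suc n ^ suc n) w _ ⟩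
  suc n ^ suc n * (w * sum xs ^ n)              ≡⟨ cong (suc n ^ suc n *_) (*-comm w (sum xs ^ n)) ⟩
  suc n ^ suc n * (sum xs ^ n * w)              ≤⟨ am-gm-step n (sum xs) w ⟩
  n ^ n * (sum xs + w) ^ suc n                  ≡⟨ cong (λ s → n ^ n * s ^ suc n) (+-comm (sum xs) w) ⟩
  n ^ n * (w + sum xs) ^ suc n                  ∎)
  where
  open ≤-Reasoning
  n = length xs
  rearrange : ∀ a b w p → a * (b * (w * p)) ≡ b * w * (a * p)
  rearrange = solve-∀

-- Hölder's inequality

-- Read a ^ r * c ≤ U ^ r as a · c^(1/r) ≤ U.
root-bound-+-ordered : ∀ r {a b c U V} → b * U ≤ a * V →
  a ^ r * c ≤ U ^ r → b ^ r * c ≤ V ^ r → (a + b) ^ r * c ≤ (U + V) ^ r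
root-bound-+-ordered zero _ ha _ = ha
root-bound-+-ordered (suc r) {a} {b} {c} {zero} _ ha hb
  with m*n≡0⇒m≡0∨n≡0 (a ^ suc r) (n≤0⇒n≡0 ha)
... | inj₁ aʳ≡0 rewrite m^n≡0⇒m≡0 a (suc r) aʳ≡0 = hb
... | inj₂ c≡0  rewrite c≡0 | *-zeroʳ ((a + b) ^ suc r) = z≤n
root-bound-+-ordered r {a} {b} {c} {U@(suc _)} {V} bU≤aV ha hb =
  *-cancelʳ-≤ _ _ (U ^ r) {{m^n≢0 U r}} (begin
    (a + b) ^ r * c * U ^ r     ≡⟨ swap ((a + b) ^ r) c (U ^ r) ⟩
    (a + b) ^ r * U ^ r * c     ≡⟨ cong (_* c) (^-distribʳ-* (a + b) U r) ⟨
    ((a + b) * U) ^ r * c       ≤⟨ *-monoˡ-≤ c (^-monoˡ-≤ r [a+b]U≤a[U+V]) ⟩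
    (a * (U + V)) ^ r * c       ≡⟨ cong (_* c) (^-distribʳ-* a (U + V) r) ⟩
    a ^ r * (U + V) ^ r * c     ≡⟨ swap (a ^ r) ((U + V) ^ r) c ⟩
    a ^ r * c * (U + V) ^ r     ≤⟨ *-monoˡ-≤ ((U + V) ^ r) ha ⟩
    U ^ r * (U + V) ^ r         ≡⟨ *-comm (U ^ r) _ ⟩
    (U + V) ^ r * U ^ r         ∎)
  where
  open ≤-Reasoning
  swap : ∀ x y z → x * y * z ≡ x * z * y
  swap = solve-∀
  [a+b]U≤a[U+V] : (a + b) * U ≤ a * (U + V)
  [a+b]U≤a[U+V] = begin
    (a + b) * U     ≡⟨ *-distribʳ-+ U a b ⟩
    a * U + b * U   ≤⟨ +-monoʳ-≤ (a * U) bU≤aV ⟩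
    a * U + a * V   ≡⟨ *-distribˡ-+ a U V ⟨
    a * (U + V)     ∎

root-bound-+ : ∀ r {a b c U V} →
  a ^ r * c ≤ U ^ r → b ^ r * c ≤ V ^ r → (a + b) ^ r * c ≤ (U + V) ^ r
root-bound-+ r {a} {b} {c} {U} {V} ha hb with ≤-total (b * U) (a * V)
... | inj₁ bU≤aV = root-bound-+-ordered r bU≤aV ha hb
... | inj₂ aV≤bU =
  subst₂ (λ x y → x ^ r * c ≤ y ^ r) (+-comm b a) (+-comm V U) (root-bound-+-ordered r aV≤bU hb ha)

*-distribˡ-sum : ∀ c xs → c * sum xs ≡ sum (map (c *_) xs)
*-distribˡ-sum c []       = *-zeroʳ c
*-distribˡ-sum c (x ∷ xs) = trans (*-distribˡ-+ c x (sum xs)) (cong (c * x +_) (*-distribˡ-sum c xs))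

product-map-*ˡ : ∀ c xs → product (map (c *_) xs) ≡ c ^ length xs * product xs
product-map-*ˡ c []       = refl
product-map-*ˡ c (x ∷ xs) rewrite product-map-*ˡ c xs = rearrange c x (c ^ length xs) (product xs)
  where
  rearrange : ∀ c x d p → c * x * (d * p) ≡ c * d * (x * p)
  rearrange = solve-∀

product-map-mono : ∀ {A : Set} {f g : A → ℕ} → (∀ x → f x ≤ g x) → ∀ xs → product (map f xs) ≤ product (map g xs)
product-map-mono f≤g []       = ≤-refl
product-map-mono f≤g (x ∷ xs) = *-mono-≤ (f≤g x) (product-map-mono f≤g xs)

∏+ : List (ℕ × ℕ) → ℕ
∏+ ps = product (map (uncurry _+_) ps)

-- The i-th weight is f (aᵢ , bᵢ) · ∏_{j ≠ i} (aⱼ + bⱼ), so the proj₁- and proj₂-weights at i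
-- add up to ∏ⱼ (aⱼ + bⱼ).
weights : (ℕ × ℕ → ℕ) → List (ℕ × ℕ) → List ℕ
weights f []       = []
weights f (x ∷ ps) = f x * ∏+ ps ∷ map (uncurry _+_ x *_) (weights f ps)

length-weights : ∀ f ps → length (weights f ps) ≡ length ps
length-weights f []       = refl
length-weights f (x ∷ ps) = cong suc (trans (length-map _ (weights f ps)) (length-weights f ps))

product-weights : ∀ f ps → product (weights f ps) * ∏+ ps ≡ product (map f ps) * ∏+ ps ^ length ps
product-weights f []       = refl
product-weights f (x ∷ ps) = begin
  f x * P * product (map (s *_) W) * (s * P)     ≡⟨ cong (λ z → f x * P * z * (s * P)) (product-map-*ˡ s W) ⟩
  f x * P * (s ^ length W * product W) * (s * P)  ≡⟨ cong (λ l → f x * P * (s ^ l * product W) * (s * P)) (length-weights f ps) ⟩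
  f x * P * (s ^ L * product W) * (s * P)         ≡⟨ rearrange (f x) P (s ^ L) (product W) s ⟩
  f x * (s * s ^ L) * P * (product W * P)         ≡⟨ cong (f x * (s * s ^ L) * P *_) (product-weights f ps) ⟩
  f x * (s * s ^ L) * P * (product (map f ps) * P ^ L)  ≡⟨ regroup (f x) (s * s ^ L) P (product (map f ps)) (P ^ L) ⟩
  f x * product (map f ps) * (s ^ suc L * (P * P ^ L))  ≡⟨ cong (f x * product (map f ps) *_) (^-distribʳ-* s P (suc L)) ⟨
  f x * product (map f ps) * (s * P) ^ suc L      ∎
  where
  open ≡-Reasoning
  s = uncurry _+_ x
  P = ∏+ ps
  W = weights f ps
  L = length ps
  rearrange : ∀ a P t w s → a * P * (t * w) * (s * P) ≡ a * (s * t) * P * (w * P)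
  rearrange = solve-∀
  regroup : ∀ a b P q r → a * b * P * (q * r) ≡ a * q * (b * (P * r))
  regroup = solve-∀

sum-weights : ∀ ps → sum (weights proj₁ ps) + sum (weights proj₂ ps) ≡ length ps * ∏+ ps
sum-weights []       = refl
sum-weights (x ∷ ps) = begin
  a * P + sum (map (s *_) W₁) + (b * P + sum (map (s *_) W₂))   ≡⟨ cong₂ (λ u v → a * P + u + (b * P + v)) (*-distribˡ-sum s W₁) (*-distribˡ-sum s W₂) ⟨
  a * P + s * sum W₁ + (b * P + s * sum W₂)                     ≡⟨ regroup a b P (sum W₁) (sum W₂) ⟩
  (a + b) * P + (a + b) * (sum W₁ + sum W₂)                     ≡⟨ cong (λ z → (a + b) * P + (a + b) * z) (sum-weights ps) ⟩
  s * P + s * (length ps * P)                                   ≡⟨ regroup′ s P (length ps) ⟩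
  suc (length ps) * (s * P)                                     ∎
  where
  open ≡-Reasoning
  a = proj₁ x
  b = proj₂ x
  s = uncurry _+_ x
  P = ∏+ ps
  W₁ = weights proj₁ ps
  W₂ = weights proj₂ ps
  regroup : ∀ a b P u v → a * P + (a + b) * u + (b * P + (a + b) * v) ≡ (a + b) * P + (a + b) * (u + v)
  regroup = solve-∀
  regroup′ : ∀ s P l → s * P + s * (l * P) ≡ (1 + l) * (s * P)
  regroup′ = solve-∀

am-gm-weights : ∀ f x ps {p} .{{_ : NonZero (∏+ (x ∷ ps))}} →
  p ^ suc (length ps) ≤ product (map f (x ∷ ps)) →
  (suc (length ps) * p) ^ suc (length ps) * ∏+ (x ∷ ps) ^ length ps ≤ sum (weights f (x ∷ ps)) ^ suc (length ps)
am-gm-weights f x ps {p} pᴿ≤ = *-cancelʳ-≤ _ _ S (begin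
  (R * p) ^ R * S ^ L * S           ≡⟨ cong (λ z → z * S ^ L * S) (^-distribʳ-* R p R) ⟩
  R ^ R * p ^ R * S ^ L * S         ≡⟨ rearrange (R ^ R) (p ^ R) (S ^ L) S ⟩
  R ^ R * (p ^ R * S ^ R)           ≤⟨ *-monoʳ-≤ (R ^ R) (*-monoˡ-≤ (S ^ R) pᴿ≤) ⟩
  R ^ R * (product (map f (x ∷ ps)) * S ^ R)   ≡⟨ cong (R ^ R *_) (product-weights f (x ∷ ps)) ⟨
  R ^ R * (product W * S)           ≡⟨ *-assoc (R ^ R) (product W) S ⟨
  R ^ R * product W * S             ≤⟨ *-monoˡ-≤ S am-gm-W ⟩
  sum W ^ R * S                     ∎)
  where
  open ≤-Reasoning
  L = length ps
  R = suc L
  S = ∏+ (x ∷ ps)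
  W = weights f (x ∷ ps)
  am-gm-W : R ^ R * product W ≤ sum W ^ R
  am-gm-W = subst (λ l → l ^ l * product W ≤ sum W ^ l) (length-weights f (x ∷ ps)) (am-gm W)
  rearrange : ∀ a b c s → a * b * c * s ≡ a * (b * (s * c))
  rearrange = solve-∀

-- AM-GM on the weights gives R p ≤ U / S^(1 - 1/R) and R q ≤ V / S^(1 - 1/R), and U + V = R S.
holder-nonZero : ∀ x ps {p q} .{{_ : NonZero (∏+ (x ∷ ps))}} →
  p ^ suc (length ps) ≤ product (map proj₁ (x ∷ ps)) →
  q ^ suc (length ps) ≤ product (map proj₂ (x ∷ ps)) →
  (p + q) ^ suc (length ps) ≤ ∏+ (x ∷ ps)
holder-nonZero x ps {p} {q} pᴿ≤ qᴿ≤ =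
  *-cancelʳ-≤ _ _ (R ^ R * S ^ L) {{m*n≢0 (R ^ R) (S ^ L) {{m^n≢0 R R}} {{m^n≢0 S L}}}} (begin
  (p + q) ^ R * (R ^ R * S ^ L)     ≡⟨ rearrange ((p + q) ^ R) (R ^ R) (S ^ L) ⟩
  R ^ R * (p + q) ^ R * S ^ L       ≡⟨ cong (_* S ^ L) (^-distribʳ-* R (p + q) R) ⟨
  (R * (p + q)) ^ R * S ^ L         ≡⟨ cong (λ z → z ^ R * S ^ L) (*-distribˡ-+ R p q) ⟩
  (R * p + R * q) ^ R * S ^ L       ≤⟨ root-bound-+ R {R * p} {R * q} {S ^ L} {U} {V}
                                         (am-gm-weights proj₁ x ps {p} pᴿ≤) (am-gm-weights proj₂ x ps {q} qᴿ≤) ⟩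
  (U + V) ^ R                       ≡⟨ cong (_^ R) (sum-weights (x ∷ ps)) ⟩
  (R * S) ^ R                       ≡⟨ ^-distribʳ-* R S R ⟩
  R ^ R * (S * S ^ L)               ≡⟨ rearrange′ (R ^ R) S (S ^ L) ⟩
  S * (R ^ R * S ^ L)               ∎)
  where
  open ≤-Reasoning
  L = length ps
  R = suc L
  S = ∏+ (x ∷ ps)
  U = sum (weights proj₁ (x ∷ ps))
  V = sum (weights proj₂ (x ∷ ps))
  rearrange : ∀ a b c → a * (b * c) ≡ b * a * c
  rearrange = solve-∀
  rearrange′ : ∀ a s c → a * (s * c) ≡ s * (a * c)
  rearrange′ = solve-∀

holder : ∀ ps {p q} →
  p ^ length ps ≤ product (map proj₁ ps) → q ^ length ps ≤ product (map proj₂ ps) →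
  (p + q) ^ length ps ≤ ∏+ ps
holder []       pᴿ≤ _   = pᴿ≤
holder (x ∷ ps) {p} {q} pᴿ≤ qᴿ≤ with ∏+ (x ∷ ps) ≟ 0
... | no S≢0  = holder-nonZero x ps {p} {q} {{≢-nonZero S≢0}} pᴿ≤ qᴿ≤
... | yes S≡0 = subst (λ z → z ^ suc (length ps) ≤ ∏+ (x ∷ ps)) (sym p+q≡0) z≤n
  where
  vanishes : ∀ f → (∀ y → f y ≤ uncurry _+_ y) → ∀ {r} → r ^ suc (length ps) ≤ product (map f (x ∷ ps)) → r ≡ 0
  vanishes f f≤ {r} rᴿ≤ = m^n≡0⇒m≡0 r (suc (length ps))
    (n≤0⇒n≡0 (≤-trans rᴿ≤ (≤-trans (product-map-mono f≤ (x ∷ ps)) (≤-reflexive S≡0))))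
  p+q≡0 : p + q ≡ 0
  p+q≡0 = cong₂ _+_ (vanishes proj₁ (λ y → m≤m+n (proj₁ y) (proj₂ y)) {p} pᴿ≤)
                    (vanishes proj₂ (λ y → m≤n+m (proj₂ y) (proj₁ y)) {q} qᴿ≤)

holder-scaled : ∀ c ps {p q} →
  p ^ length ps ≤ c * product (map proj₁ ps) → q ^ length ps ≤ c * product (map proj₂ ps) →
  (p + q) ^ length ps ≤ c * ∏+ ps
holder-scaled c []             pᴿ≤ _   = pᴿ≤
holder-scaled c ((a , b) ∷ ps) {p} {q} pᴿ≤ qᴿ≤ =
  subst ((p + q) ^ suc (length ps) ≤_) absorb
    (holder ((c * a , c * b) ∷ ps) {p} {q}
      (subst (p ^ suc (length ps) ≤_) (sym (*-assoc c a _)) pᴿ≤)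
      (subst (q ^ suc (length ps) ≤_) (sym (*-assoc c b _)) qᴿ≤))
  where
  absorb : (c * a + c * b) * ∏+ ps ≡ c * ((a + b) * ∏+ ps)
  absorb = trans (sym (cong (_* ∏+ ps) (*-distribˡ-+ c a b))) (*-assoc c (a + b) _)

∏ : ∀ {k} → (Fin k → ℕ) → ℕ
∏ {zero}  f = 1
∏ {suc k} f = f zero * ∏ (f ∘ suc)

∏-cong : ∀ {k} {f g : Fin k → ℕ} → (∀ j → f j ≡ g j) → ∏ f ≡ ∏ g
∏-cong {zero}  f≗g = refl
∏-cong {suc k} f≗g = cong₂ _*_ (f≗g zero) (∏-cong (f≗g ∘ suc))

∏-mono : ∀ {k} {f g : Fin k → ℕ} → (∀ j → f j ≤ g j) → ∏ f ≤ ∏ g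
∏-mono {zero}  f≤g = ≤-refl
∏-mono {suc k} f≤g = *-mono-≤ (f≤g zero) (∏-mono (f≤g ∘ suc))

∏-pos : ∀ {k} {f : Fin k → ℕ} → (∀ j → 0 < f j) → 0 < ∏ f
∏-pos {zero}  f>0 = z<s
∏-pos {suc k} f>0 = *-mono-≤ (f>0 zero) (∏-pos (f>0 ∘ suc))

∏-const : ∀ k c → ∏ {k} (λ _ → c) ≡ c ^ k
∏-const zero    c = refl
∏-const (suc k) c = cong (c *_) (∏-const k c)

selected : ∀ {k} → Subset k → (Fin k → ℕ) → (Fin k → ℕ) → List (ℕ × ℕ)
selected []          a b = []
selected (true ∷ s)  a b = (a zero , b zero) ∷ selected s (a ∘ suc) (b ∘ suc)
selected (false ∷ s) a b = selected s (a ∘ suc) (b ∘ suc)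

length-selected : ∀ {k} (s : Subset k) (a b : Fin k → ℕ) → length (selected s a b) ≡ ∣ s ∣
length-selected []          a b = refl
length-selected (true ∷ s)  a b = cong suc (length-selected s (a ∘ suc) (b ∘ suc))
length-selected (false ∷ s) a b = length-selected s (a ∘ suc) (b ∘ suc)

∏-select : ∀ {k} (f : ℕ × ℕ → ℕ) (s : Subset k) (a b c : Fin k → ℕ) →
  ∏ (λ j → if lookup s j then f (a j , b j) else c j) ≡
  ∏ (λ j → if lookup s j then 1 else c j) * product (map f (selected s a b))
∏-select f []          a b c = refl
∏-select f (true ∷ s)  a b c = begin
  f (a zero , b zero) * ∏ (λ j → if lookup s j then f (a (suc j) , b (suc j)) else c (suc j))
    ≡⟨ cong (f (a zero , b zero) *_) (∏-select f s (a ∘ suc) (b ∘ suc) (c ∘ suc)) ⟩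
  f (a zero , b zero) * (U * P)   ≡⟨ rearrange (f (a zero , b zero)) U P ⟩
  1 * U * (f (a zero , b zero) * P) ∎
  where
  open ≡-Reasoning
  U = ∏ (λ j → if lookup s j then 1 else c (suc j))
  P = product (map f (selected s (a ∘ suc) (b ∘ suc)))
  rearrange : ∀ x U P → x * (U * P) ≡ 1 * U * (x * P)
  rearrange = solve-∀
∏-select f (false ∷ s) a b c =
  trans (cong (c zero *_) (∏-select f s (a ∘ suc) (b ∘ suc) (c ∘ suc))) (sym (*-assoc (c zero) _ _))

holder-select : ∀ {k} (s : Subset k) (a b c : Fin k → ℕ) {p q} →
  p ^ ∣ s ∣ ≤ ∏ (λ j → if lookup s j then a j else c j) →
  q ^ ∣ s ∣ ≤ ∏ (λ j → if lookup s j then b j else c j) →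
  (p + q) ^ ∣ s ∣ ≤ ∏ (λ j → if lookup s j then a j + b j else c j)
holder-select s a b c {p} {q} pᴿ≤ qᴿ≤ =
  subst₂ (λ l z → (p + q) ^ l ≤ z) (length-selected s a b) (sym (∏-select (uncurry _+_) s a b c))
    (holder-scaled U ps (rewrite-bound proj₁ pᴿ≤) (rewrite-bound proj₂ qᴿ≤))
  where
  U = ∏ (λ j → if lookup s j then 1 else c j)
  ps = selected s a b
  rewrite-bound : ∀ f {r} → r ^ ∣ s ∣ ≤ ∏ (λ j → if lookup s j then f (a j , b j) else c j) →
    r ^ length ps ≤ U * product (map f ps)
  rewrite-bound f {r} = subst₂ (λ l z → r ^ l ≤ z) (sym (length-selected s a b)) (∏-select f s a b c)

-- Shearer's lemma

countSublists : ∀ {X : Set} → (List X → Bool) → List X → ℕ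
countSublists P []       = if P [] then 1 else 0
countSublists P (x ∷ xs) = countSublists (P ∘ (x ∷_)) xs + countSublists P xs

countSublists-pos : ∀ {X : Set} (P : List X → Bool) L → 0 < countSublists P L → ∃ λ S → P S ≡ true
countSublists-pos P [] pos with P [] in P[]
... | true  = [] , P[]
... | false = contradiction pos (<-irrefl refl)
countSublists-pos P (x ∷ xs) pos with countSublists (P ∘ (x ∷_)) xs ≟ 0
... | yes c≡0 = countSublists-pos P xs (subst (λ c → 0 < c + countSublists P xs) c≡0 pos)
... | no  c≢0 with countSublists-pos (P ∘ (x ∷_)) xs (n≢0⇒n>0 c≢0)
...   | S , PxS = x ∷ S , PxS

countSublists-map : ∀ {X Y : Set} (P : List Y → Bool) (f : X → Y) L →
  countSublists (P ∘ map f) L ≡ countSublists P (map f L)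
countSublists-map P f []      = refl
countSublists-map P f (x ∷ L) = cong₂ _+_ (countSublists-map (P ∘ (f x ∷_)) f L) (countSublists-map P f L)

module _ {X : Set} {k : ℕ} (A : X → Subset k) where

  _↾_ : List X → Fin k → List X
  L ↾ j = filterᵇ (λ x → lookup (A x) j) L

  ∷-↾ : ∀ x S j → (x ∷ S) ↾ j ≡ (if lookup (A x) j then x ∷ (S ↾ j) else S ↾ j)
  ∷-↾ x S j with lookup (A x) j
  ... | true  = refl
  ... | false = refl

  -- Families are the sublists of L satisfying P; the trace of a family S on the j-th coordinate
  -- set {x : j ∈ A x} is S ↾ j, and Q j must hold of all traces.
  shearer : ∀ {r} L (P : List X → Bool) (Q : Fin k → List X → Bool) →
    (∀ S → P S ≡ true → All (λ x → ∣ A x ∣ ≡ suc r) S) →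
    (∀ S → P S ≡ true → ∀ j → Q j (S ↾ j) ≡ true) →
    countSublists P L ^ suc r ≤ ∏ (λ j → countSublists (Q j) (L ↾ j))
  shearer {r} [] P Q sized proj with P [] in P[]
  ... | false = z≤n
  ... | true  = ≤-trans (≤-reflexive (^-zeroˡ (suc r)))
    (∏-pos λ j → subst (λ β → 0 < (if β then 1 else 0)) (sym (proj [] P[] j)) z<s)
  shearer {r} (x ∷ xs) P Q sized proj = split (c₁ ≟ 0)
    where
    c₁ = countSublists (P ∘ (x ∷_)) xs
    c₀ = countSublists P xs
    a b : Fin k → ℕ
    a j = countSublists (Q j ∘ (x ∷_)) (xs ↾ j)
    b j = countSublists (Q j) (xs ↾ j)
    Qₓ : Fin k → List X → Bool
    Qₓ j = if lookup (A x) j then Q j ∘ (x ∷_) else Q j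

    count-∷ : ∀ j → countSublists (Q j) ((x ∷ xs) ↾ j) ≡ (if lookup (A x) j then a j + b j else b j)
    count-∷ j = trans (cong (countSublists (Q j)) (∷-↾ x xs j)) (if-float (countSublists (Q j)) (lookup (A x) j))

    projₓ : ∀ S → P (x ∷ S) ≡ true → ∀ j → Qₓ j (S ↾ j) ≡ true
    projₓ S PxS j = begin
      Qₓ j (S ↾ j)                                                 ≡⟨ if-float (λ F → F (S ↾ j)) (lookup (A x) j) {Q j ∘ (x ∷_)} {Q j} ⟩
      (if lookup (A x) j then Q j (x ∷ (S ↾ j)) else Q j (S ↾ j))  ≡⟨ if-float (Q j) (lookup (A x) j) ⟨
      Q j (if lookup (A x) j then x ∷ (S ↾ j) else S ↾ j)          ≡⟨ cong (Q j) (∷-↾ x S j) ⟨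
      Q j ((x ∷ S) ↾ j)                                            ≡⟨ proj (x ∷ S) PxS j ⟩
      true                                                         ∎
      where open ≡-Reasoning

    with-x : c₁ ^ suc r ≤ ∏ (λ j → if lookup (A x) j then a j else b j)
    with-x = subst (c₁ ^ suc r ≤_)
      (∏-cong λ j → if-float (λ F → countSublists F (xs ↾ j)) (lookup (A x) j) {Q j ∘ (x ∷_)} {Q j})
      (shearer xs (P ∘ (x ∷_)) Qₓ (λ S → All.tail ∘ sized (x ∷ S)) projₓ)

    without-x : c₀ ^ suc r ≤ ∏ (λ j → if lookup (A x) j then b j else b j)
    without-x = subst (c₀ ^ suc r ≤_) (∏-cong λ j → sym (if-eta (lookup (A x) j))) (shearer xs P Q sized proj)

    -- Split the families by whether they contain x; if some do, x lies in exactly r + 1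
    -- coordinate sets and Hölder's inequality combines the two induction hypotheses.
    split : Dec (c₁ ≡ 0) → (c₁ + c₀) ^ suc r ≤ ∏ (λ j → countSublists (Q j) ((x ∷ xs) ↾ j))
    split (yes c₁≡0) = subst (λ c → (c + c₀) ^ suc r ≤ _) (sym c₁≡0)
      (≤-trans (shearer xs P Q sized proj) (∏-mono λ j → subst (b j ≤_) (sym (count-∷ j)) (b≤ (lookup (A x) j))))
      where
      b≤ : ∀ {j} β → b j ≤ (if β then a j + b j else b j)
      b≤ true  = m≤n+m _ _
      b≤ false = ≤-refl
    split (no c₁≢0) with countSublists-pos (P ∘ (x ∷_)) xs (n≢0⇒n>0 c₁≢0)
    ... | S , PxS = subst₂ (λ e z → (c₁ + c₀) ^ e ≤ z) ∣Aₓ∣≡ (sym (∏-cong count-∷))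
      (holder-select (A x) a b b
        (subst (λ e → c₁ ^ e ≤ ∏ (λ j → if lookup (A x) j then a j else b j)) (sym ∣Aₓ∣≡) with-x)
        (subst (λ e → c₀ ^ e ≤ ∏ (λ j → if lookup (A x) j then b j else b j)) (sym ∣Aₓ∣≡) without-x))
      where
      ∣Aₓ∣≡ : ∣ A x ∣ ≡ suc r
      ∣Aₓ∣≡ = All.head (sized (x ∷ S) PxS)

length-filter-map-∷ : ∀ {X : Set} {p} {P : Pred (List X) p} (P? : Decidable P) x Ss →
  length (filter P? (map (x ∷_) Ss)) ≡ length (filter (P? ∘ (x ∷_)) Ss)
length-filter-map-∷ P? x []       = refl
length-filter-map-∷ P? x (S ∷ Ss) with does (P? (x ∷ S))
... | true  = cong suc (length-filter-map-∷ P? x Ss)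
... | false = length-filter-map-∷ P? x Ss

length-filter-sublists : ∀ {X : Set} {p} {P : Pred (List X) p} (P? : Decidable P) L →
  length (filter P? (sublists L)) ≡ countSublists (does ∘ P?) L
length-filter-sublists P? [] with does (P? [])
... | true  = refl
... | false = refl
length-filter-sublists P? (x ∷ xs) = begin
  length (filter P? (map (x ∷_) (sublists xs) ++ sublists xs))
    ≡⟨ cong length (filter-++ P? (map (x ∷_) (sublists xs)) (sublists xs)) ⟩
  length (filter P? (map (x ∷_) (sublists xs)) ++ filter P? (sublists xs))
    ≡⟨ length-++ (filter P? (map (x ∷_) (sublists xs))) ⟩
  length (filter P? (map (x ∷_) (sublists xs))) + length (filter P? (sublists xs))
    ≡⟨ cong₂ _+_ (trans (length-filter-map-∷ P? x (sublists xs)) (length-filter-sublists (P? ∘ (x ∷_)) xs))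
                 (length-filter-sublists P? xs) ⟩
  countSublists (does ∘ P? ∘ (x ∷_)) xs + countSublists (does ∘ P?) xs ∎
  where open ≡-Reasoning

-- The link (below) of a loop is empty, so the empty family is counted too: it is the + 1 in m n r + 1.
isMatroidOrEmpty : ∀ {n} → ℕ → Collection n → Bool
isMatroidOrEmpty r []        = true
isMatroidOrEmpty r 𝓑@(_ ∷ _) = does (isMatroid? r 𝓑)

isMatroidOrEmpty⇔ : ∀ {n} r (𝓑 : Collection n) →
  isMatroidOrEmpty r 𝓑 ≡ true ⇔ (All (λ B → ∣ B ∣ ≡ r) 𝓑 × BaseExchange 𝓑)
isMatroidOrEmpty⇔ r []          = mk⇔ (λ _ → [] , []) (λ _ → refl)
isMatroidOrEmpty⇔ r 𝓑@(_ ∷ _) = mk⇔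
  (λ h → proj₂ (toWitness (Equivalence.from T-≡ (trans (isYes≗does (isMatroid? r 𝓑)) h))))
  (λ (sized , exchange) → dec-true (isMatroid? r 𝓑) (z<s , sized , exchange))

countSublists-isMatroidOrEmpty : ∀ {n} r (L : List (Subset n)) →
  countSublists (isMatroidOrEmpty r) L ≡ countSublists (does ∘ isMatroid? r) L + 1
countSublists-isMatroidOrEmpty r []       = refl
countSublists-isMatroidOrEmpty r (B ∷ L) =
  trans (cong (countSublists (does ∘ isMatroid? r ∘ (B ∷_)) L +_) (countSublists-isMatroidOrEmpty r L))
        (sym (+-assoc (countSublists (does ∘ isMatroid? r ∘ (B ∷_)) L) _ 1))

m+1≡countSublists : ∀ n r → m n r + 1 ≡ countSublists (isMatroidOrEmpty r) (allSubsets n)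
m+1≡countSublists n r = sym (trans (countSublists-isMatroidOrEmpty r (allSubsets n))
  (cong (_+ 1) (sym (length-filter-sublists (isMatroid? r) (allSubsets n)))))

-- Links

zipWith-insertAt : ∀ {A B C : Set} {n} (f : A → B → C) (xs : Vec A n) (ys : Vec B n) (i : Fin (suc n)) {x y} →
  zipWith f (insertAt xs i x) (insertAt ys i y) ≡ insertAt (zipWith f xs ys) i (f x y)
zipWith-insertAt f xs       ys       zero    = refl
zipWith-insertAt f (x ∷ xs) (y ∷ ys) (suc i) = cong (f x y ∷_) (zipWith-insertAt f xs ys i)

insertAt-⊥ : ∀ {n} (i : Fin (suc n)) → insertAt ⊥ i false ≡ ⊥
insertAt-⊥         zero    = refl
insertAt-⊥ {suc n} (suc i) = cong (false ∷_) (insertAt-⊥ i)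

⁅punchIn⁆ : ∀ {n} (e : Fin (suc n)) (i : Fin n) → ⁅ punchIn e i ⁆ ≡ insertAt ⁅ i ⁆ e false
⁅punchIn⁆ zero    i       = refl
⁅punchIn⁆ (suc e) zero    = cong (true ∷_) (sym (insertAt-⊥ e))
⁅punchIn⁆ (suc e) (suc i) = cong (false ∷_) (⁅punchIn⁆ e i)

∣insertAt-true∣ : ∀ {n} (B : Subset n) (e : Fin (suc n)) → ∣ insertAt B e true ∣ ≡ suc ∣ B ∣
∣insertAt-true∣ B           zero    = refl
∣insertAt-true∣ (true ∷ B)  (suc e) = cong suc (∣insertAt-true∣ B e)
∣insertAt-true∣ (false ∷ B) (suc e) = ∣insertAt-true∣ B e

punchIn-∈-insertAt : ∀ {n} (B : Subset n) (e : Fin (suc n)) β i → punchIn e i ∈ insertAt B e β ⇔ i ∈ B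
punchIn-∈-insertAt B e β i = mk⇔
  (λ h → lookup⇒[]= i B (trans (sym (insertAt-punchIn B e β i)) ([]=⇒lookup h)))
  (λ h → lookup⇒[]= (punchIn e i) (insertAt B e β) (trans (insertAt-punchIn B e β i) ([]=⇒lookup h)))

insertAt-exchange : ∀ {n} (B : Subset n) (e : Fin (suc n)) x y →
  (insertAt B e true - punchIn e x) ∪ ⁅ punchIn e y ⁆ ≡ insertAt ((B - x) ∪ ⁅ y ⁆) e true
insertAt-exchange B e x y = begin
  (insertAt B e true - punchIn e x) ∪ ⁅ punchIn e y ⁆
    ≡⟨ cong₂ (λ u v → (insertAt B e true ─ u) ∪ v) (⁅punchIn⁆ e x) (⁅punchIn⁆ e y) ⟩
  (insertAt B e true ─ insertAt ⁅ x ⁆ e false) ∪ insertAt ⁅ y ⁆ e false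
    ≡⟨ cong (_∪ insertAt ⁅ y ⁆ e false) (zipWith-insertAt _ B ⁅ x ⁆ e) ⟩
  insertAt (B - x) e true ∪ insertAt ⁅ y ⁆ e false
    ≡⟨ zipWith-insertAt _∨_ (B - x) ⁅ y ⁆ e ⟩
  insertAt ((B - x) ∪ ⁅ y ⁆) e true ∎
  where open ≡-Reasoning

-- {B ∖ e : e ∈ B ∈ 𝓑}; for a matroid in which e is not a loop, the bases of the contraction by e.
link : ∀ {n} → Fin (suc n) → Collection (suc n) → Collection n
link e 𝓑 = map (λ B → removeAt B e) (filterᵇ (λ B → lookup B e) 𝓑)

∈-link⁺ : ∀ {n} {e : Fin (suc n)} {𝓑 B} → insertAt B e true ∈ₗ 𝓑 → B ∈ₗ link e 𝓑
∈-link⁺ {e = e} {B = B} B⁺∈𝓑 = ∈-map∘filter⁺ (λ B → removeAt B e) (T? ∘ λ B → lookup B e)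
  (insertAt B e true , B⁺∈𝓑 , sym (removeAt-insertAt B e true) , Equivalence.from T-≡ (insertAt-lookup B e true))

∈-link⁻ : ∀ {n} {e : Fin (suc n)} {𝓑 B} → B ∈ₗ link e 𝓑 → insertAt B e true ∈ₗ 𝓑
∈-link⁻ {e = e} {𝓑} B∈link with ∈-map∘filter⁻ (λ B → removeAt B e) (T? ∘ λ B → lookup B e) B∈link
... | B⁺ , B⁺∈𝓑 , refl , e∈B⁺ = subst (_∈ₗ 𝓑) (sym reinsert) B⁺∈𝓑
  where
  reinsert : insertAt (removeAt B⁺ e) e true ≡ B⁺
  reinsert = trans (cong (insertAt (removeAt B⁺ e) e) (sym (Equivalence.to T-≡ e∈B⁺))) (insertAt-removeAt B⁺ e)

link-sized : ∀ {n r} (e : Fin (suc n)) {𝓑} → All (λ B → ∣ B ∣ ≡ suc r) 𝓑 → All (λ B → ∣ B ∣ ≡ r) (link e 𝓑)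
link-sized e {𝓑} sized = All.tabulate λ {B} B∈ →
  suc-injective (trans (sym (∣insertAt-true∣ B e)) (All.lookup sized (∈-link⁻ B∈)))

link-exchange : ∀ {n} (e : Fin (suc n)) {𝓑} → BaseExchange 𝓑 → BaseExchange (link e 𝓑)
link-exchange e {𝓑} exchange =
  All.tabulate λ B₁∈ → All.tabulate λ B₂∈ → exchangeAt (∈-link⁻ B₁∈) (∈-link⁻ B₂∈)
  where
  exchangeAt : ∀ {B₁ B₂} → insertAt B₁ e true ∈ₗ 𝓑 → insertAt B₂ e true ∈ₗ 𝓑 → ExchangeAt (link e 𝓑) B₁ B₂
  exchangeAt {B₁} {B₂} B₁⁺∈ B₂⁺∈ x x∈B₁ x∉B₂
    with All.lookup (All.lookup exchange B₁⁺∈) B₂⁺∈ (punchIn e x)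
           (Equivalence.from (punchIn-∈-insertAt B₁ e true x) x∈B₁)
           (x∉B₂ ∘ Equivalence.to (punchIn-∈-insertAt B₂ e true x))
  ... | f , f∈B₂⁺ , f∉B₁⁺ , B′∈𝓑 = y , y∈B₂ , y∉B₁ , ∈-link⁺ B′⁺∈𝓑
    where
    e≢f : e ≢ f
    e≢f refl = f∉B₁⁺ (lookup⇒[]= e _ (insertAt-lookup B₁ e true))
    y = punchOut e≢f
    f≡y : f ≡ punchIn e y
    f≡y = sym (punchIn-punchOut e≢f)
    y∈B₂ : y ∈ B₂
    y∈B₂ = Equivalence.to (punchIn-∈-insertAt B₂ e true y) (subst (_∈ insertAt B₂ e true) f≡y f∈B₂⁺)
    y∉B₁ : y ∉ B₁
    y∉B₁ = f∉B₁⁺ ∘ subst (_∈ insertAt B₁ e true) (sym f≡y) ∘ Equivalence.from (punchIn-∈-insertAt B₁ e true y)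
    B′⁺∈𝓑 : insertAt ((B₁ - x) ∪ ⁅ y ⁆) e true ∈ₗ 𝓑
    B′⁺∈𝓑 = subst (_∈ₗ 𝓑) (insertAt-exchange B₁ e x y) (subst (λ g → (insertAt B₁ e true - punchIn e x) ∪ ⁅ g ⁆ ∈ₗ 𝓑) f≡y B′∈𝓑)

isMatroidOrEmpty-link : ∀ {n} r (e : Fin (suc n)) 𝓑 →
  isMatroidOrEmpty (suc r) 𝓑 ≡ true → isMatroidOrEmpty r (link e 𝓑) ≡ true
isMatroidOrEmpty-link r e 𝓑 h =
  let sized , exchange = Equivalence.to (isMatroidOrEmpty⇔ (suc r) 𝓑) h
  in Equivalence.from (isMatroidOrEmpty⇔ r (link e 𝓑)) (link-sized e sized , link-exchange e exchange)

link-++ : ∀ {n} (e : Fin (suc n)) 𝓑 𝓒 → link e (𝓑 ++ 𝓒) ≡ link e 𝓑 ++ link e 𝓒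
link-++ e 𝓑 𝓒 = trans (cong (map (λ B → removeAt B e)) (filter-++ (T? ∘ λ B → lookup B e) 𝓑 𝓒))
  (map-++ (λ B → removeAt B e) (filterᵇ (λ B → lookup B e) 𝓑) _)

link-zero-true : ∀ {n} (𝓑 : Collection n) → link zero (map (true ∷_) 𝓑) ≡ 𝓑
link-zero-true []      = refl
link-zero-true (B ∷ 𝓑) = cong (B ∷_) (link-zero-true 𝓑)

link-zero-false : ∀ {n} (𝓑 : Collection n) → link zero (map (false ∷_) 𝓑) ≡ []
link-zero-false []      = refl
link-zero-false (B ∷ 𝓑) = link-zero-false 𝓑

link-suc : ∀ {n} (e : Fin (suc n)) β (𝓑 : Collection (suc n)) → link (suc e) (map (β ∷_) 𝓑) ≡ map (β ∷_) (link e 𝓑)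
link-suc e β []            = refl
link-suc e β ((b ∷ B) ∷ 𝓑) with lookup (b ∷ B) e
... | true  = cong ((β ∷ removeAt (b ∷ B) e) ∷_) (link-suc e β 𝓑)
... | false = link-suc e β 𝓑

link-allSubsets : ∀ {n} (e : Fin (suc n)) → link e (allSubsets (suc n)) ≡ allSubsets n
link-allSubsets {n} zero = begin
  link zero (map (true ∷_) (allSubsets n) ++ map (false ∷_) (allSubsets n))
    ≡⟨ link-++ zero (map (true ∷_) (allSubsets n)) _ ⟩
  link zero (map (true ∷_) (allSubsets n)) ++ link zero (map (false ∷_) (allSubsets n))
    ≡⟨ cong₂ _++_ (link-zero-true (allSubsets n)) (link-zero-false (allSubsets n)) ⟩
  allSubsets n ++ []
    ≡⟨ ++-identityʳ (allSubsets n) ⟩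
  allSubsets n ∎
  where open ≡-Reasoning
link-allSubsets {suc n} (suc e) = begin
  link (suc e) (map (true ∷_) (allSubsets (suc n)) ++ map (false ∷_) (allSubsets (suc n)))
    ≡⟨ link-++ (suc e) (map (true ∷_) (allSubsets (suc n))) _ ⟩
  link (suc e) (map (true ∷_) (allSubsets (suc n))) ++ link (suc e) (map (false ∷_) (allSubsets (suc n)))
    ≡⟨ cong₂ _++_ (link-suc e true (allSubsets (suc n))) (link-suc e false (allSubsets (suc n))) ⟩
  map (true ∷_) (link e (allSubsets (suc n))) ++ map (false ∷_) (link e (allSubsets (suc n)))
    ≡⟨ cong (λ 𝓑 → map (true ∷_) 𝓑 ++ map (false ∷_) 𝓑) (link-allSubsets e) ⟩
  allSubsets (suc n) ∎
  where open ≡-Reasoning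

matroid-count-bound : ∀ n r → (m (suc n) (suc r) + 1) ^ suc r ≤ (m n r + 1) ^ suc n
matroid-count-bound n r = begin
  (m (suc n) (suc r) + 1) ^ suc r
    ≡⟨ cong (_^ suc r) (m+1≡countSublists (suc n) (suc r)) ⟩
  countSublists (isMatroidOrEmpty (suc r)) (allSubsets (suc n)) ^ suc r
    ≤⟨ shearer (λ B → B) (allSubsets (suc n)) (isMatroidOrEmpty (suc r)) Q
         (λ 𝓑 → proj₁ ∘ Equivalence.to (isMatroidOrEmpty⇔ (suc r) 𝓑))
         (λ 𝓑 h e → isMatroidOrEmpty-link r e 𝓑 h) ⟩
  ∏ (λ e → countSublists (Q e) (filterᵇ (λ B → lookup B e) (allSubsets (suc n))))
    ≡⟨ ∏-cong link-count ⟩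
  ∏ {suc n} (λ _ → m n r + 1)
    ≡⟨ ∏-const (suc n) (m n r + 1) ⟩
  (m n r + 1) ^ suc n ∎
  where
  open ≤-Reasoning
  Q : Fin (suc n) → Collection (suc n) → Bool
  Q e = isMatroidOrEmpty r ∘ map (λ B → removeAt B e)
  link-count : ∀ e → countSublists (Q e) (filterᵇ (λ B → lookup B e) (allSubsets (suc n))) ≡ m n r + 1
  link-count e =
    trans (countSublists-map (isMatroidOrEmpty r) (λ B → removeAt B e) (filterᵇ (λ B → lookup B e) (allSubsets (suc n))))
      (trans (cong (countSublists (isMatroidOrEmpty r)) (link-allSubsets e)) (sym (m+1≡countSublists n r)))

nCk>0 : ∀ {n k} → k ≤ n → n C k > 0
nCk>0 {zero}  {zero}  _         = z<s
nCk>0 {suc n} {zero}  _         = z<s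
nCk>0 {suc n} {suc k} (s≤s k≤n) = subst (_> 0) (nCk+nC[k+1]≡[n+1]C[k+1] n k) (≤-trans (nCk>0 k≤n) (m≤m+n _ _))

absorption : ∀ n k → suc k * (suc n C suc k) ≡ suc n * (n C k)
absorption zero    zero    = refl
absorption zero    (suc k) = *-zeroʳ (suc (suc k))
absorption (suc n) zero    = trans (*-identityˡ _) (trans (nC1≡n (suc (suc n))) (sym (*-identityʳ (suc (suc n)))))
absorption (suc n) (suc k) = begin
  (2 + k) * ((2 + n) C (2 + k))
    ≡⟨ cong ((2 + k) *_) (nCk+nC[k+1]≡[n+1]C[k+1] (suc n) (suc k)) ⟨
  (2 + k) * ((1 + n) C (1 + k) + (1 + n) C (2 + k))
    ≡⟨ regroup ((1 + n) C (1 + k)) ((1 + n) C (2 + k)) k ⟩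
  (1 + n) C (1 + k) + ((1 + k) * ((1 + n) C (1 + k)) + (2 + k) * ((1 + n) C (2 + k)))
    ≡⟨ cong₂ (λ u v → (1 + n) C (1 + k) + (u + v)) (absorption n k) (absorption n (suc k)) ⟩
  (1 + n) C (1 + k) + ((1 + n) * (n C k) + (1 + n) * (n C (1 + k)))
    ≡⟨ cong ((1 + n) C (1 + k) +_) (*-distribˡ-+ (1 + n) (n C k) (n C (1 + k))) ⟨
  (1 + n) C (1 + k) + (1 + n) * (n C k + n C (1 + k))
    ≡⟨ cong (λ z → (1 + n) C (1 + k) + (1 + n) * z) (nCk+nC[k+1]≡[n+1]C[k+1] n k) ⟩
  (1 + n) C (1 + k) + (1 + n) * ((1 + n) C (1 + k))
    ∎
  where
  open ≡-Reasoning
  regroup : ∀ a b k → (2 + k) * (a + b) ≡ a + ((1 + k) * a + (2 + k) * b)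
  regroup = solve-∀

-- Read x ^ q ≤ y ^ p as log x / p ≤ log y / q.
^≤^-trans : ∀ {x y z} p q s .{{_ : NonZero q}} → x ^ q ≤ y ^ p → y ^ s ≤ z ^ q → x ^ s ≤ z ^ p
^≤^-trans {x} {y} {z} p q s xᵠ≤yᵖ yˢ≤zᵠ = ^-cancelʳ-≤ q (begin
  (x ^ s) ^ q   ≡⟨ ^-swap x s q ⟩
  (x ^ q) ^ s   ≤⟨ ^-monoˡ-≤ s xᵠ≤yᵖ ⟩
  (y ^ p) ^ s   ≡⟨ ^-swap y p s ⟩
  (y ^ s) ^ p   ≤⟨ ^-monoˡ-≤ p yˢ≤zᵠ ⟩
  (z ^ q) ^ p   ≡⟨ ^-swap z q p ⟩
  (z ^ p) ^ q   ∎)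
  where open ≤-Reasoning

^≤^-rescale : ∀ {x y} p q p′ q′ .{{_ : NonZero p}} → p * q′ ≡ q * p′ → x ^ q ≤ y ^ p → x ^ q′ ≤ y ^ p′
^≤^-rescale {x} {y} p q p′ q′ pq′≡qp′ xᵠ≤yᵖ = ^-cancelʳ-≤ p (begin
  (x ^ q′) ^ p    ≡⟨ ^-*-assoc x q′ p ⟩
  x ^ (q′ * p)    ≡⟨ cong (x ^_) (trans (*-comm q′ p) pq′≡qp′) ⟩
  x ^ (q * p′)    ≡⟨ ^-*-assoc x q p′ ⟨
  (x ^ q) ^ p′    ≤⟨ ^-monoˡ-≤ p′ xᵠ≤yᵖ ⟩
  (y ^ p) ^ p′    ≡⟨ ^-swap y p p′ ⟩
  (y ^ p′) ^ p    ∎)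
  where open ≤-Reasoning

lemma2 : (n r t : ℕ) → t ≤ r → r ≤ n →
    (m n r + 1) ^ ((n ∸ t) C (r ∸ t)) ≤ (m (n ∸ t) (r ∸ t) + 1) ^ (n C r)
lemma2 n       r       zero    _         _         = ≤-refl
lemma2 (suc n) (suc r) (suc t) (s≤s t≤r) (s≤s r≤n) =
  ^≤^-trans (suc n C suc r) (n C r) ((n ∸ t) C (r ∸ t)) {{>-nonZero (nCk>0 r≤n)}}
    (^≤^-rescale (suc n) (suc r) (suc n C suc r) (n C r) (sym (absorption n r)) (matroid-count-bound n r))
    (lemma2 n r t t≤r r≤n)
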